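{- Let $M$ be a partition matroid on a ground set $E=\{e_1,\ldots,e_n\}$ and, for $i\in\{0,\ldots,n\}$, let $E_i=\{e_1,\ldots,e_i\}$. Then the number of minors of $M$ on $E\setminus E_i$ is at most $2^{\lambda_M(E_i)}$.
   Context: A partition matroid is a direct sum of uniform matroids, where a uniform matroid of rank $r$ has as independent sets exactly the subsets of its ground set of size at most $r$, and the direct sum $M_1\oplus M_2$ of matroids on disjoint ground sets has independent sets $I_1\cup I_2$ with $I_j$ independent in $M_j$. $r_M$ is the rank function, $r(M)=r_M(E)$, and $\lambda_M(X)=r_M(X)+r_M(E\setminus X)-r(M)$ is the connectivity function. For disjoint $X,Y\subseteq E$, $M\setminus X/Y$ is the matroid obtained by deleting $X$ and contracting $Y$. The minors of $M$ on $E\setminus E_i$ are the matroids $M\setminus(E_i\setminus Y)/Y$ for $Y\subseteq E_i$; their number is the number of distinct such matroids. -}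

module Defs where

open import Data.Bool using (Bool; true; false; _∧_)
open import Data.Bool.Properties using () renaming (_≟_ to _≟ᵇ_)
open import Data.Nat using (ℕ; _+_; _∸_; _⊔_; _≤ᵇ_; _<ᵇ_; _≡ᵇ_)
open import Data.Fin using (Fin; toℕ) renaming (_≟_ to _≟ᶠ_)
open import Data.Fin.Subset using (Subset; ∣_∣; _∩_; _∪_; ∁; ⊤)
open import Data.List using (List; []; _∷_; map; _++_; filterᵇ; foldr; allFin; length; deduplicate)
open import Data.List.Properties using (≡-dec)
open import Data.Vec using (Vec; []; _∷_; tabulate)
open import Relation.Nullary using (does)
open import Relation.Unary using (Pred)

-- A partition matroid on the ground set E = Fin n (element e_{k+1} is the
-- index k), given as a direct sum of m uniform matroids: element e lies in
-- block (block e), and block j carries the uniform matroid of rank (rank j).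
record PartitionMatroid (n : ℕ) : Set where
  field
    m     : ℕ
    block : Fin n → Fin m
    rank  : Fin m → ℕ

subsetsOf : ∀ {n} → Subset n → List (Subset n)
subsetsOf [] = [] ∷ []
subsetsOf (true ∷ X) = map (true ∷_) (subsetsOf X) ++ map (false ∷_) (subsetsOf X)
subsetsOf (false ∷ X) = map (false ∷_) (subsetsOf X)

allᵇ : ∀ {A : Set} → (A → Bool) → List A → Bool
allᵇ p = foldr (λ x b → p x ∧ b) true

module _ {n : ℕ} (M : PartitionMatroid n) where
  open PartitionMatroid M

  blockSet : Fin m → Subset n
  blockSet j = tabulate (λ e → does (block e ≟ᶠ j))

  indep : Subset n → Bool
  indep I = allᵇ (λ j → ∣ I ∩ blockSet j ∣ ≤ᵇ rank j) (allFin m)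

  r : Subset n → ℕ
  r X = foldr _⊔_ 0 (map ∣_∣ (filterᵇ indep (subsetsOf X)))

  conn : Subset n → ℕ
  conn X = r X + r (∁ X) ∸ r ⊤

  -- independence in the minor M \ X / Y (for X, Y disjoint), tested on a set I
  -- disjoint from X ∪ Y:  I independent in M\X/Y  iff  r(I ∪ Y) = |I| + r(Y).
  minorIndep : Subset n → Subset n → Subset n → Bool
  minorIndep X Y I = (r (I ∪ Y) ≡ᵇ ∣ I ∣ + r Y)

prefix : ∀ n → ℕ → Subset n
prefix n i = tabulate (λ k → toℕ k <ᵇ i)

module _ {n : ℕ} (M : PartitionMatroid n) (i : ℕ) where
  private
    Ei = prefix n i
    -- the matroid M\(E_i∖Y)/Y on E∖E_i, represented by its table of
    -- independent sets (indexed by the list of all subsets of E∖E_i);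
    -- two such matroids are equal iff their tables are equal
    minorTable : Subset n → List Bool
    minorTable Y = map (minorIndep M (Ei ∩ ∁ Y) Y) (subsetsOf (∁ Ei))

  numMinors : ℕ
  numMinors = length (deduplicate (≡-dec _≟ᵇ_) (map minorTable (subsetsOf Ei)))

-- The rank of a partition matroid with blocks Bⱼ of ranks rⱼ is
-- r(X) = Σⱼ min(|X ∩ Bⱼ|, rⱼ). For Y ⊆ A and I ⊆ E∖A this turns the equation
-- r(I ∪ Y) = |I| + r(Y), which says that I is independent in M∖(A∖Y)/Y, into the
-- blockwise conditions |I ∩ Bⱼ| ≤ rⱼ − |Y ∩ Bⱼ|. Hence the minor is determined by
-- the vector sⱼ = min(|Bⱼ∖A|, rⱼ − |Y ∩ Bⱼ|), and as Y ranges over the subsets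
-- of A, sⱼ ranges over an interval of length λⱼ, the connectivity of A ∩ Bⱼ in
-- the j-th uniform summand. Connectivity is additive over direct sums, so there
-- are at most Πⱼ (λⱼ + 1) ≤ 2^λ(A) minors. This works for any A in place of Eᵢ.
module Submission where

open import Defs
open import Data.Bool as Bool using (Bool; true; false; _∧_; _∨_; not; T)
open import Data.Bool.Properties using (T-∧; T-≡; ⇔→≡) renaming (_≟_ to _≟ᵇ_; ≤-refl to ≤ᵇ-refl)
open import Data.Empty using (⊥-elim)
open import Data.Fin using (Fin; zero; suc) renaming (_≟_ to _≟ᶠ_)
open import Data.Fin.Subset using (Subset; ∣_∣; _∩_; _∪_; ∁; ⊤)
open import Data.Fin.Subset.Properties using (∪-inverseˡ)
open import Data.List
  using (List; []; _∷_; [_]; _++_; map; foldr; filterᵇ; allFin; tabulate; applyUpTo;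
         cartesianProductWith; length; deduplicate)
open import Data.List.Membership.Propositional using (_∈_)
open import Data.List.Membership.Propositional.Properties
  using (∈-map⁺; ∈-map⁻; ∈-++⁺ˡ; ∈-++⁺ʳ; ∈-++⁻; ∈-∃++; ∈-filter⁺; ∈-filter⁻;
         ∈-applyUpTo⁺; ∈-cartesianProductWith⁺)
open import Data.List.Properties using (length-++; length-map; length-applyUpTo; map-cong-local; ≡-dec)
open import Data.List.Relation.Binary.Subset.Propositional using (_⊆_)
open import Data.List.Relation.Unary.All as All using ()
open import Data.List.Relation.Unary.AllPairs using (_∷_)
open import Data.List.Relation.Unary.Any using (here; there)
open import Data.List.Relation.Unary.Any.Properties using (deduplicate⁻)
open import Data.List.Relation.Unary.Unique.Propositional using (Unique)
open import Data.List.Relation.Unary.Unique.DecPropositional.Properties using (deduplicate-!)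
open import Data.Nat
open import Data.Nat.Properties
open import Algebra.Properties.CommutativeMonoid.Sum +-0-commutativeMonoid
  using (sum; sum-cong-≗; ∑-distrib-+; sum-replicate-zero)
open import Algebra.Properties.CommutativeSemigroup +-commutativeSemigroup using (interchange)
open import Data.Product using (∃-syntax; _×_; _,_; proj₁; proj₂)
open import Data.Sum using (inj₁; inj₂)
open import Data.Unit using (tt)
open import Data.Vec using (Vec; []; _∷_; lookup) renaming (tabulate to vtabulate)
open import Data.Vec.Properties using (lookup∘tabulate)
open import Data.Vec.Relation.Binary.Pointwise.Inductive as Pointwise using (Pointwise; []; _∷_)
open import Function using (_∘_; _$_)
open import Function.Bundles using (_⇔_; mk⇔; Equivalence)
open import Function.Properties.Equivalence using () renaming (sym to ⇔-sym; trans to ⇔-trans)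
open import Relation.Binary.Definitions using (DecidableEquality)
open import Relation.Binary.PropositionalEquality hiding ([_])
open import Relation.Nullary using (does; yes; no)
open import Relation.Nullary.Decidable using (T?)

T-⇔⇒≡ : ∀ {x y} → T x ⇔ T y → x ≡ y
T-⇔⇒≡ x⇔y = ⇔→≡ (⇔-trans (⇔-sym T-≡) (⇔-trans x⇔y T-≡))

T-allᵇ-tabulate : ∀ {A : Set} {k} (p : A → Bool) (f : Fin k → A) →
  T (allᵇ p (tabulate f)) ⇔ (∀ j → T (p (f j)))
T-allᵇ-tabulate {k = zero} p f = mk⇔ (λ _ ()) (λ _ → tt)
T-allᵇ-tabulate {k = suc k} p f = mk⇔ to from
  where
  rest = T-allᵇ-tabulate p (f ∘ suc)
  to : T (allᵇ p (tabulate f)) → ∀ j → T (p (f j))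
  to t zero = proj₁ (Equivalence.to T-∧ t)
  to t (suc j) = Equivalence.to rest (proj₂ (Equivalence.to T-∧ t)) j
  from : (∀ j → T (p (f j))) → T (allᵇ p (tabulate f))
  from h = Equivalence.from T-∧ (h zero , Equivalence.from rest (h ∘ suc))

[m+n]⊓o≤m+n⊓o : ∀ m n o → (m + n) ⊓ o ≤ m + n ⊓ o
[m+n]⊓o≤m+n⊓o m n o =
  ≤-trans (⊓-monoʳ-≤ (m + n) (m≤n+m o m)) (≤-reflexive (sym (+-distribˡ-⊓ m n o)))

[m+n]⊓o≤m⊓o+n⊓o : ∀ m n o → (m + n) ⊓ o ≤ m ⊓ o + n ⊓ o
[m+n]⊓o≤m⊓o+n⊓o m n o with ≤-total m o
... | inj₁ m≤o =
  subst (λ k → (m + n) ⊓ o ≤ k + n ⊓ o) (sym (m≤n⇒m⊓n≡m m≤o)) ([m+n]⊓o≤m+n⊓o m n o)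
... | inj₂ o≤m =
  ≤-trans (m⊓n≤n (m + n) o) (subst (_≤ m ⊓ o + n ⊓ o) (m≥n⇒m⊓n≡n o≤m) (m≤m+n _ _))

m+n⊓[o∸m]≡[m+n]⊓o : ∀ {m o} n → m ≤ o → m + n ⊓ (o ∸ m) ≡ (m + n) ⊓ o
m+n⊓[o∸m]≡[m+n]⊓o {m} {o} n m≤o =
  trans (+-distribˡ-⊓ m n (o ∸ m)) (cong ((m + n) ⊓_) (m+[n∸m]≡n m≤o))

m≤o∸n⇒[m+n]⊓o≡m+n⊓o : ∀ m n o → m ≤ o ∸ n → (m + n) ⊓ o ≡ m + n ⊓ o
m≤o∸n⇒[m+n]⊓o≡m+n⊓o m n o m≤o∸n with ≤-total n o
... | inj₁ n≤o = trans (m≤n⇒m⊓n≡m m+n≤o) (cong (m +_) (sym (m≤n⇒m⊓n≡m n≤o)))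
  where m+n≤o = subst (m + n ≤_) (m∸n+n≡m n≤o) (+-monoˡ-≤ n m≤o∸n)
... | inj₂ o≤n with subst (m ≤_) (m≤n⇒m∸n≡0 o≤n) m≤o∸n
... | z≤n = refl

[m+n]⊓o≡m+n⊓o⇒m≤o∸n : ∀ m n o → (m + n) ⊓ o ≡ m + n ⊓ o → m ≤ o ∸ n
[m+n]⊓o≡m+n⊓o⇒m≤o∸n m n o eq with ≤-total n o
... | inj₁ n≤o = m+n≤o⇒m≤o∸n m (m⊓n≡m⇒m≤n (trans eq (cong (m +_) (m≤n⇒m⊓n≡m n≤o))))
... | inj₂ o≤n = subst (_≤ o ∸ n) (sym m≡0) z≤n
  where
  o≡m+o : o ≡ m + o
  o≡m+o = trans (sym (m≥n⇒m⊓n≡n (≤-trans o≤n (m≤n+m n m))))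
                (trans eq (cong (m +_) (m≥n⇒m⊓n≡n o≤n)))
  m≡0 : m ≡ 0
  m≡0 = +-cancelʳ-≡ o m 0 (sym o≡m+o)

-- The connectivity λ(X) of a set X with |X| = a, |E∖X| = b in the uniform matroid U_{r,a+b}.
uniformConn : ℕ → ℕ → ℕ → ℕ
uniformConn r a b = a ⊓ r + b ⊓ r ∸ (a + b) ⊓ r

n⊓o≡n⊓[o∸m]+uniformConn : ∀ m n o → n ⊓ o ≡ n ⊓ (o ∸ m) + uniformConn o m n
n⊓o≡n⊓[o∸m]+uniformConn m n o with ≤-total m o
... | inj₁ m≤o = sym $ begin
    n ⊓ (o ∸ m) + (m ⊓ o + n ⊓ o ∸ (m + n) ⊓ o)
  ≡⟨ cong₂ (λ u v → n ⊓ (o ∸ m) + (u + n ⊓ o ∸ v))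
           (m≤n⇒m⊓n≡m m≤o) (sym (m+n⊓[o∸m]≡[m+n]⊓o n m≤o)) ⟩
    n ⊓ (o ∸ m) + (m + n ⊓ o ∸ (m + n ⊓ (o ∸ m)))
  ≡⟨ cong (n ⊓ (o ∸ m) +_) ([m+n]∸[m+o]≡n∸o m (n ⊓ o) (n ⊓ (o ∸ m))) ⟩
    n ⊓ (o ∸ m) + (n ⊓ o ∸ n ⊓ (o ∸ m))
  ≡⟨ m+[n∸m]≡n (⊓-monoʳ-≤ n (m∸n≤m o m)) ⟩
    n ⊓ o ∎
  where open ≡-Reasoning
... | inj₂ o≤m = sym $ begin
    n ⊓ (o ∸ m) + (m ⊓ o + n ⊓ o ∸ (m + n) ⊓ o)
  ≡⟨ cong₂ (λ u v → n ⊓ u + (v + n ⊓ o ∸ (m + n) ⊓ o)) (m≤n⇒m∸n≡0 o≤m) (m≥n⇒m⊓n≡n o≤m) ⟩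
    n ⊓ 0 + (o + n ⊓ o ∸ (m + n) ⊓ o)
  ≡⟨ cong₂ (λ u v → u + (o + n ⊓ o ∸ v))
           (⊓-zeroʳ n) (m≥n⇒m⊓n≡n (≤-trans o≤m (m≤m+n m n))) ⟩
    o + n ⊓ o ∸ o
  ≡⟨ m+n∸m≡n o (n ⊓ o) ⟩
    n ⊓ o ∎
  where open ≡-Reasoning

suc≤2^ : ∀ x → suc x ≤ 2 ^ x
suc≤2^ zero = ≤-refl
suc≤2^ (suc x) = +-mono-≤ (≤-trans (s≤s z≤n) (suc≤2^ x)) (≤-trans (suc≤2^ x) (m≤m+n _ 0))

sum-mono-≤ : ∀ {m} {f g : Fin m → ℕ} → (∀ j → f j ≤ g j) → sum f ≤ sum g
sum-mono-≤ {zero} f≤g = z≤n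
sum-mono-≤ {suc m} f≤g = +-mono-≤ (f≤g zero) (sum-mono-≤ (f≤g ∘ suc))

sum-mono-≤-tight : ∀ {m} {f g : Fin m → ℕ} → (∀ j → f j ≤ g j) → sum g ≤ sum f → ∀ j → f j ≡ g j
sum-mono-≤-tight {suc m} {f} {g} f≤g Σg≤Σf zero = ≤-antisym (f≤g zero) $
  +-cancelʳ-≤ (sum (f ∘ suc)) (g zero) (f zero)
    (≤-trans (+-monoʳ-≤ (g zero) (sum-mono-≤ (f≤g ∘ suc))) Σg≤Σf)
sum-mono-≤-tight {suc m} {f} {g} f≤g Σg≤Σf (suc j) = sum-mono-≤-tight (f≤g ∘ suc)
  (+-cancelˡ-≤ (f zero) _ _ (≤-trans (+-monoˡ-≤ (sum (g ∘ suc)) (f≤g zero)) Σg≤Σf)) j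

sum-∸ : ∀ {m} (f g : Fin m → ℕ) → (∀ j → g j ≤ f j) → sum (λ j → f j ∸ g j) ≡ sum f ∸ sum g
sum-∸ f g g≤f = begin
    sum (λ j → f j ∸ g j)
  ≡⟨ sym (m+n∸n≡m _ (sum g)) ⟩
    sum (λ j → f j ∸ g j) + sum g ∸ sum g
  ≡⟨ cong (_∸ sum g) (sym (∑-distrib-+ (λ j → f j ∸ g j) g)) ⟩
    sum (λ j → f j ∸ g j + g j) ∸ sum g
  ≡⟨ cong (_∸ sum g) (sum-cong-≗ (λ j → m∸n+n≡m (g≤f j))) ⟩
    sum f ∸ sum g ∎
  where open ≡-Reasoning

indicator : Bool → ℕ
indicator true = 1
indicator false = 0

δ : ∀ {m} → Fin m → Fin m → ℕ
δ k j = indicator (does (k ≟ᶠ j))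

sum-δ : ∀ {m} (k : Fin m) → sum (δ k) ≡ 1
sum-δ {suc m} zero = cong suc (sum-replicate-zero m)
sum-δ {suc m} (suc k) = sum-δ k

length-cartesianProductWith : ∀ {A B C : Set} (f : A → B → C) xs ys →
  length (cartesianProductWith f xs ys) ≡ length xs * length ys
length-cartesianProductWith f [] ys = refl
length-cartesianProductWith f (x ∷ xs) ys =
  trans (length-++ (map (f x) ys))
        (cong₂ _+_ (length-map (f x) ys) (length-cartesianProductWith f xs ys))

interval : ℕ → ℕ → List ℕ
interval lo len = applyUpTo (lo +_) (suc len)

∈-interval : ∀ {lo len x} → lo ≤ x → x ≤ lo + len → x ∈ interval lo len
∈-interval {lo} {len} {x} lo≤x x≤lo+len = subst (_∈ interval lo len) (m+[n∸m]≡n lo≤x) $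
  ∈-applyUpTo⁺ (lo +_) (s≤s (subst (x ∸ lo ≤_) (m+n∸m≡n lo len) (∸-monoˡ-≤ lo x≤lo+len)))

box : ∀ {m} → (Fin m → ℕ) → (Fin m → ℕ) → List (Vec ℕ m)
box {zero} lo len = [ [] ]
box {suc m} lo len = cartesianProductWith _∷_ (interval (lo zero) (len zero)) (box (lo ∘ suc) (len ∘ suc))

tabulate∈box : ∀ {m} {lo len f : Fin m → ℕ} → (∀ j → lo j ≤ f j × f j ≤ lo j + len j) →
  vtabulate f ∈ box lo len
tabulate∈box {zero} bounds = here refl
tabulate∈box {suc m} bounds = ∈-cartesianProductWith⁺ _∷_
  (∈-interval (proj₁ (bounds zero)) (proj₂ (bounds zero))) (tabulate∈box (bounds ∘ suc))

length-box : ∀ {m} (lo len : Fin m → ℕ) → length (box lo len) ≤ 2 ^ sum len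
length-box {zero} lo len = ≤-refl
length-box {suc m} lo len = begin
    length (box lo len)
  ≡⟨ length-cartesianProductWith _∷_ (interval (lo zero) (len zero)) (box (lo ∘ suc) (len ∘ suc)) ⟩
    length (interval (lo zero) (len zero)) * length (box (lo ∘ suc) (len ∘ suc))
  ≡⟨ cong (_* length (box (lo ∘ suc) (len ∘ suc))) (length-applyUpTo (lo zero +_) (suc (len zero))) ⟩
    suc (len zero) * length (box (lo ∘ suc) (len ∘ suc))
  ≤⟨ *-mono-≤ (suc≤2^ (len zero)) (length-box (lo ∘ suc) (len ∘ suc)) ⟩
    2 ^ len zero * 2 ^ sum (len ∘ suc)
  ≡⟨ sym (^-distribˡ-+-* 2 (len zero) _) ⟩
    2 ^ sum len ∎
  where open ≤-Reasoning

unique-⊆⇒length-≤ : ∀ {A : Set} {xs ys : List A} → Unique xs → xs ⊆ ys → length xs ≤ length ys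
unique-⊆⇒length-≤ {xs = []} _ _ = z≤n
unique-⊆⇒length-≤ {xs = x ∷ xs} (x∉xs ∷ xs!) xs⊆ys
  with ys₁ , ys₂ , refl ← ∈-∃++ (xs⊆ys (here refl)) =
  subst (suc (length xs) ≤_) (sym length-ys) (s≤s (unique-⊆⇒length-≤ xs! xs⊆ys₁++ys₂))
  where
  length-ys : length (ys₁ ++ [ x ] ++ ys₂) ≡ suc (length (ys₁ ++ ys₂))
  length-ys = trans (length-++ ys₁)
    (trans (+-suc (length ys₁) (length ys₂)) (cong suc (sym (length-++ ys₁))))
  xs⊆ys₁++ys₂ : xs ⊆ ys₁ ++ ys₂
  xs⊆ys₁++ys₂ z∈xs with ∈-++⁻ ys₁ (xs⊆ys (there z∈xs))
  ... | inj₁ z∈ys₁ = ∈-++⁺ˡ z∈ys₁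
  ... | inj₂ (here refl) = ⊥-elim (All.lookup x∉xs z∈xs refl)
  ... | inj₂ (there z∈ys₂) = ∈-++⁺ʳ ys₁ z∈ys₂

length-deduplicate-map-≤ : ∀ {A B : Set} (_≟_ : DecidableEquality B) (f : A → B) xs ys →
  (∀ {x} → x ∈ xs → f x ∈ ys) → length (deduplicate _≟_ (map f xs)) ≤ length ys
length-deduplicate-map-≤ _≟_ f xs ys f∈ys = unique-⊆⇒length-≤ (deduplicate-! _≟_ (map f xs)) ⊆ys
  where
  ⊆ys : deduplicate _≟_ (map f xs) ⊆ ys
  ⊆ys y∈ with x , x∈xs , refl ← ∈-map⁻ f (deduplicate⁻ _≟_ y∈) = f∈ys x∈xs

infix 4 _⊑_
_⊑_ : ∀ {n} → Subset n → Subset n → Set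
_⊑_ = Pointwise Bool._≤_

⊑-refl : ∀ {n} {X : Subset n} → X ⊑ X
⊑-refl = Pointwise.refl ≤ᵇ-refl

∈-subsetsOf⁻ : ∀ {n} (X : Subset n) {I} → I ∈ subsetsOf X → I ⊑ X
∈-subsetsOf⁻ [] (here refl) = []
∈-subsetsOf⁻ (true ∷ X) I∈ with ∈-++⁻ (map (true ∷_) (subsetsOf X)) I∈
... | inj₁ I∈ˡ with J , J∈ , refl ← ∈-map⁻ (true ∷_) I∈ˡ = Bool.b≤b ∷ ∈-subsetsOf⁻ X J∈
... | inj₂ I∈ʳ with J , J∈ , refl ← ∈-map⁻ (false ∷_) I∈ʳ = Bool.f≤t ∷ ∈-subsetsOf⁻ X J∈
∈-subsetsOf⁻ (false ∷ X) I∈ with J , J∈ , refl ← ∈-map⁻ (false ∷_) I∈ = Bool.b≤b ∷ ∈-subsetsOf⁻ X J∈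

∈-subsetsOf⁺ : ∀ {n} {I X : Subset n} → I ⊑ X → I ∈ subsetsOf X
∈-subsetsOf⁺ [] = here refl
∈-subsetsOf⁺ (Bool.b≤b {true} ∷ I⊑X) = ∈-++⁺ˡ (∈-map⁺ _ (∈-subsetsOf⁺ I⊑X))
∈-subsetsOf⁺ {X = _ ∷ X} (Bool.f≤t ∷ I⊑X) =
  ∈-++⁺ʳ (map (true ∷_) (subsetsOf X)) (∈-map⁺ _ (∈-subsetsOf⁺ I⊑X))
∈-subsetsOf⁺ (Bool.b≤b {false} ∷ I⊑X) = ∈-map⁺ _ (∈-subsetsOf⁺ I⊑X)

blockCount : ∀ {n m} → (Fin n → Fin m) → Subset n → Fin m → ℕ
blockCount b [] j = 0
blockCount b (x ∷ X) j = indicator (x ∧ does (b zero ≟ᶠ j)) + blockCount (b ∘ suc) X j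

∣∩fibre∣≡blockCount : ∀ {n m} (b : Fin n → Fin m) X j →
  ∣ X ∩ vtabulate (λ e → does (b e ≟ᶠ j)) ∣ ≡ blockCount b X j
∣∩fibre∣≡blockCount b [] j = refl
∣∩fibre∣≡blockCount b (x ∷ X) j with x ∧ does (b zero ≟ᶠ j)
... | true = cong suc (∣∩fibre∣≡blockCount (b ∘ suc) X j)
... | false = ∣∩fibre∣≡blockCount (b ∘ suc) X j

∣∣≡sum-blockCount : ∀ {n m} (b : Fin n → Fin m) X → ∣ X ∣ ≡ sum (blockCount b X)
∣∣≡sum-blockCount {m = m} b [] = sym (sum-replicate-zero m)
∣∣≡sum-blockCount b (false ∷ X) = ∣∣≡sum-blockCount (b ∘ suc) X
∣∣≡sum-blockCount b (true ∷ X) = begin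
    suc ∣ X ∣
  ≡⟨ cong₂ _+_ (sym (sum-δ (b zero))) (∣∣≡sum-blockCount (b ∘ suc) X) ⟩
    sum (δ (b zero)) + sum (blockCount (b ∘ suc) X)
  ≡⟨ sym (∑-distrib-+ (δ (b zero)) (blockCount (b ∘ suc) X)) ⟩
    sum (blockCount b (true ∷ X)) ∎
  where open ≡-Reasoning

indicator-∧-mono : ∀ {x y} d → x Bool.≤ y → indicator (x ∧ d) ≤ indicator (y ∧ d)
indicator-∧-mono d Bool.f≤t = z≤n
indicator-∧-mono d Bool.b≤b = ≤-refl

blockCount-mono : ∀ {n m} (b : Fin n → Fin m) {I X} → I ⊑ X → ∀ j → blockCount b I j ≤ blockCount b X j
blockCount-mono b [] j = z≤n
blockCount-mono b (i≤x ∷ I⊑X) j = +-mono-≤ (indicator-∧-mono _ i≤x) (blockCount-mono (b ∘ suc) I⊑X j)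

indicator-∨-disjoint : ∀ {a i y} d → i Bool.≤ not a → y Bool.≤ a →
  indicator ((i ∨ y) ∧ d) ≡ indicator (i ∧ d) + indicator (y ∧ d)
indicator-∨-disjoint {true} {false} {true} d _ _ = refl
indicator-∨-disjoint {true} {false} {false} d _ _ = refl
indicator-∨-disjoint {true} {true} d () _
indicator-∨-disjoint {false} {_} {true} d _ ()
indicator-∨-disjoint {false} {true} {false} true _ _ = refl
indicator-∨-disjoint {false} {true} {false} false _ _ = refl
indicator-∨-disjoint {false} {false} {false} d _ _ = refl

blockCount-∪ : ∀ {n m} (b : Fin n → Fin m) {A I Y : Subset n} → I ⊑ ∁ A → Y ⊑ A → ∀ j →
  blockCount b (I ∪ Y) j ≡ blockCount b I j + blockCount b Y j
blockCount-∪ b {[]} [] [] j = refl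
blockCount-∪ b {_ ∷ _} {i ∷ _} {y ∷ _} (i≤¬a ∷ I⊑∁A) (y≤a ∷ Y⊑A) j =
  trans (cong₂ _+_ (indicator-∨-disjoint d i≤¬a y≤a) (blockCount-∪ (b ∘ suc) I⊑∁A Y⊑A j))
        (interchange (indicator (i ∧ d)) _ _ _)
  where d = does (b zero ≟ᶠ j)

-- Greedily keep an element of X while the budget c of its block is positive.
∃-cappedSubset : ∀ {n m} (b : Fin n → Fin m) (c : Fin m → ℕ) X →
  ∃[ G ] G ⊑ X × (∀ j → blockCount b G j ≡ blockCount b X j ⊓ c j)
∃-cappedSubset b c [] = [] , [] , λ _ → refl
∃-cappedSubset b c (false ∷ X) with G , G⊑X , count-G ← ∃-cappedSubset (b ∘ suc) c X =
  false ∷ G , Bool.b≤b ∷ G⊑X , count-G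
∃-cappedSubset b c (true ∷ X) with c (b zero) in c₀≡
... | zero with G , G⊑X , count-G ← ∃-cappedSubset (b ∘ suc) c X =
  false ∷ G , Bool.f≤t ∷ G⊑X , λ j → trans (count-G j) (full j)
  where
  full : ∀ j → blockCount (b ∘ suc) X j ⊓ c j ≡ (δ (b zero) j + blockCount (b ∘ suc) X j) ⊓ c j
  full j with b zero ≟ᶠ j
  ... | yes refl rewrite c₀≡ = trans (⊓-zeroʳ _) (sym (⊓-zeroʳ (suc (blockCount (b ∘ suc) X j))))
  ... | no _ = refl
... | suc _ with G , G⊑X , count-G ← ∃-cappedSubset (b ∘ suc) (λ j → c j ∸ δ (b zero) j) X =
  true ∷ G , Bool.b≤b ∷ G⊑X , λ j →
    trans (cong (δ (b zero) j +_) (count-G j)) (m+n⊓[o∸m]≡[m+n]⊓o _ (room j))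
  where
  room : ∀ j → δ (b zero) j ≤ c j
  room j with b zero ≟ᶠ j
  ... | yes refl rewrite c₀≡ = s≤s z≤n
  ... | no _ = z≤n

≤-foldr-⊔ : ∀ {y} ys → y ∈ ys → y ≤ foldr _⊔_ 0 ys
≤-foldr-⊔ (y ∷ ys) (here refl) = m≤m⊔n y _
≤-foldr-⊔ (x ∷ ys) (there y∈ys) = ≤-trans (≤-foldr-⊔ ys y∈ys) (m≤n⊔m x _)

foldr-⊔-lub : ∀ {v} ys → (∀ {y} → y ∈ ys → y ≤ v) → foldr _⊔_ 0 ys ≤ v
foldr-⊔-lub [] _ = z≤n
foldr-⊔-lub (y ∷ ys) ≤v = ⊔-lub (≤v (here refl)) (foldr-⊔-lub ys (≤v ∘ there))

-- The rank of a partition matroid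

module _ {n : ℕ} (M : PartitionMatroid n) where
  open PartitionMatroid M

  count : Subset n → Fin m → ℕ
  count = blockCount block

  T-indep⇔ : ∀ I → T (indep M I) ⇔ (∀ j → count I j ≤ rank j)
  T-indep⇔ I = mk⇔
    (λ t j → subst (_≤ rank j) (∣∩fibre∣≡blockCount block I j) (≤ᵇ⇒≤ _ _ (Equivalence.to fits t j)))
    (λ h → Equivalence.from fits λ j →
      ≤⇒≤ᵇ (subst (_≤ rank j) (sym (∣∩fibre∣≡blockCount block I j)) (h j)))
    where fits = T-allᵇ-tabulate (λ j → ∣ I ∩ blockSet M j ∣ ≤ᵇ rank j) (λ j → j)

  r≡sum : ∀ X → r M X ≡ sum (λ j → count X j ⊓ rank j)
  r≡sum X with G , G⊑X , count-G ← ∃-cappedSubset block rank X =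
    ≤-antisym (foldr-⊔-lub _ independent≤) (subst (_≤ r M X) ∣G∣≡ (≤-foldr-⊔ _ ∣G∣∈))
    where
    independent≤ : ∀ {y} → y ∈ map ∣_∣ (filterᵇ (indep M) (subsetsOf X)) → y ≤ sum (λ j → count X j ⊓ rank j)
    independent≤ y∈ with I , I∈ , refl ← ∈-map⁻ ∣_∣ y∈
                    with I⊆X , indep-I ← ∈-filter⁻ (T? ∘ indep M) I∈ =
      subst (_≤ _) (sym (∣∣≡sum-blockCount block I)) $ sum-mono-≤ λ j →
        ⊓-glb (blockCount-mono block (∈-subsetsOf⁻ X I⊆X) j) (Equivalence.to (T-indep⇔ I) indep-I j)
    ∣G∣∈ : ∣ G ∣ ∈ map ∣_∣ (filterᵇ (indep M) (subsetsOf X))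
    ∣G∣∈ = ∈-map⁺ ∣_∣ (∈-filter⁺ (T? ∘ indep M) (∈-subsetsOf⁺ G⊑X)
      (Equivalence.from (T-indep⇔ G) (λ j → subst (_≤ rank j) (sym (count-G j)) (m⊓n≤n _ _))))
    ∣G∣≡ : ∣ G ∣ ≡ sum (λ j → count X j ⊓ rank j)
    ∣G∣≡ = trans (∣∣≡sum-blockCount block G) (sum-cong-≗ count-G)

  conn≡sum-uniformConn : ∀ A → conn M A ≡ sum (λ j → uniformConn (rank j) (count A j) (count (∁ A) j))
  conn≡sum-uniformConn A = begin
      r M A + r M (∁ A) ∸ r M ⊤
    ≡⟨ cong₂ _∸_ (cong₂ _+_ (r≡sum A) (r≡sum (∁ A))) (r≡sum ⊤) ⟩
      sum rank[A] + sum rank[∁A] ∸ sum (λ j → count ⊤ j ⊓ rank j)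
    ≡⟨ cong₂ _∸_ (sym (∑-distrib-+ rank[A] rank[∁A]))
                 (sum-cong-≗ (λ j → cong (_⊓ rank j) (count-⊤ j))) ⟩
      sum (λ j → rank[A] j + rank[∁A] j) ∸ sum rank[E]
    ≡⟨ sym (sum-∸ (λ j → rank[A] j + rank[∁A] j) rank[E]
                  (λ j → [m+n]⊓o≤m⊓o+n⊓o (a j) (b j) (rank j))) ⟩
      sum (λ j → uniformConn (rank j) (a j) (b j)) ∎
    where
    open ≡-Reasoning
    a b rank[A] rank[∁A] rank[E] : Fin m → ℕ
    a = count A
    b = count (∁ A)
    rank[A] j = a j ⊓ rank j
    rank[∁A] j = b j ⊓ rank j
    rank[E] j = (a j + b j) ⊓ rank j
    count-⊤ : ∀ j → count ⊤ j ≡ a j + b j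
    count-⊤ j = trans (cong (λ U → count U j) (sym (∪-inverseˡ A)))
      (trans (blockCount-∪ block {A} ⊑-refl ⊑-refl j) (+-comm (b j) (a j)))

  T-minorIndep⇔ : ∀ {A} X {Y I} → Y ⊑ A → I ⊑ ∁ A →
    T (minorIndep M X Y I) ⇔ (∀ j → count I j ≤ rank j ∸ count Y j)
  T-minorIndep⇔ X {Y} {I} Y⊑A I⊑∁A = mk⇔ to from
    where
    rank[I∪Y] rank[I]+rank[Y] : Fin m → ℕ
    rank[I∪Y] j = (count I j + count Y j) ⊓ rank j
    rank[I]+rank[Y] j = count I j + count Y j ⊓ rank j

    r[I∪Y]≡ : r M (I ∪ Y) ≡ sum rank[I∪Y]
    r[I∪Y]≡ = trans (r≡sum (I ∪ Y)) (sum-cong-≗ λ j → cong (_⊓ rank j) (blockCount-∪ block I⊑∁A Y⊑A j))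

    ∣I∣+r[Y]≡ : ∣ I ∣ + r M Y ≡ sum rank[I]+rank[Y]
    ∣I∣+r[Y]≡ = trans (cong₂ _+_ (∣∣≡sum-blockCount block I) (r≡sum Y))
      (sym (∑-distrib-+ (count I) (λ j → count Y j ⊓ rank j)))

    to : T (minorIndep M X Y I) → ∀ j → count I j ≤ rank j ∸ count Y j
    to t j = [m+n]⊓o≡m+n⊓o⇒m≤o∸n (count I j) (count Y j) (rank j)
      (sum-mono-≤-tight (λ j → [m+n]⊓o≤m+n⊓o (count I j) (count Y j) (rank j)) (≤-reflexive Σ≡) j)
      where Σ≡ = trans (sym ∣I∣+r[Y]≡) (trans (sym (≡ᵇ⇒≡ _ _ t)) r[I∪Y]≡)

    from : (∀ j → count I j ≤ rank j ∸ count Y j) → T (minorIndep M X Y I)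
    from fits = ≡⇒≡ᵇ _ _ (trans r[I∪Y]≡ (trans (sum-cong-≗ termwise) (sym ∣I∣+r[Y]≡)))
      where termwise = λ j → m≤o∸n⇒[m+n]⊓o≡m+n⊓o (count I j) (count Y j) (rank j) (fits j)

-- Minors on the complement of a set

module Minors {n : ℕ} (M : PartitionMatroid n) (A : Subset n) where
  open PartitionMatroid M

  a b lo len : Fin m → ℕ
  a = count M A
  b = count M (∁ A)
  lo j = b j ⊓ (rank j ∸ a j)
  len j = uniformConn (rank j) (a j) (b j)

  slack : Subset n → Vec ℕ m
  slack Y = vtabulate (λ j → b j ⊓ (rank j ∸ count M Y j))

  fitsUnder : Vec ℕ m → Subset n → Bool
  fitsUnder s I = allᵇ (λ j → count M I j ≤ᵇ lookup s j) (allFin m)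

  fitsTable : Vec ℕ m → List Bool
  fitsTable s = map (fitsUnder s) (subsetsOf (∁ A))

  minorTable : Subset n → List Bool
  minorTable Y = map (minorIndep M (A ∩ ∁ Y) Y) (subsetsOf (∁ A))

  T-fitsUnder-slack⇔ : ∀ {Y I} → I ⊑ ∁ A →
    T (fitsUnder (slack Y) I) ⇔ (∀ j → count M I j ≤ rank j ∸ count M Y j)
  T-fitsUnder-slack⇔ {Y} {I} I⊑∁A = mk⇔
    (λ t j → m≤n⊓o⇒m≤o (b j) _ (subst (count M I j ≤_) (slack-j j) (≤ᵇ⇒≤ _ _ (Equivalence.to fits t j))))
    (λ h → Equivalence.from fits λ j → ≤⇒≤ᵇ $ subst (count M I j ≤_) (sym (slack-j j)) $
      ⊓-glb (blockCount-mono block I⊑∁A j) (h j))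
    where
    fits = T-allᵇ-tabulate (λ j → count M I j ≤ᵇ lookup (slack Y) j) (λ j → j)
    slack-j = lookup∘tabulate (λ j → b j ⊓ (rank j ∸ count M Y j))

  minorTable≡fitsTable-slack : ∀ {Y} → Y ⊑ A → minorTable Y ≡ fitsTable (slack Y)
  minorTable≡fitsTable-slack {Y} Y⊑A = map-cong-local $ All.tabulate λ I∈ →
    let I⊑∁A = ∈-subsetsOf⁻ (∁ A) I∈
    in T-⇔⇒≡ (⇔-trans (T-minorIndep⇔ M (A ∩ ∁ Y) Y⊑A I⊑∁A) (⇔-sym (T-fitsUnder-slack⇔ {Y} I⊑∁A)))

  slack∈box : ∀ {Y} → Y ⊑ A → slack Y ∈ box lo len
  slack∈box {Y} Y⊑A = tabulate∈box λ j →
    ⊓-monoʳ-≤ (b j) (∸-monoʳ-≤ (rank j) (blockCount-mono block Y⊑A j)) ,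
    ≤-trans (⊓-monoʳ-≤ (b j) (m∸n≤m (rank j) (count M Y j)))
            (≤-reflexive (n⊓o≡n⊓[o∸m]+uniformConn (a j) (b j) (rank j)))

  numMinorTables≤ : length (deduplicate (≡-dec _≟ᵇ_) (map minorTable (subsetsOf A))) ≤ 2 ^ conn M A
  numMinorTables≤ = begin
      length (deduplicate (≡-dec _≟ᵇ_) (map minorTable (subsetsOf A)))
    ≤⟨ length-deduplicate-map-≤ (≡-dec _≟ᵇ_) minorTable (subsetsOf A) (map fitsTable (box lo len)) table∈ ⟩
      length (map fitsTable (box lo len))
    ≡⟨ length-map fitsTable (box lo len) ⟩
      length (box lo len)
    ≤⟨ length-box lo len ⟩
      2 ^ sum len
    ≡⟨ cong (2 ^_) (sym (conn≡sum-uniformConn M A)) ⟩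
      2 ^ conn M A ∎
    where
    open ≤-Reasoning
    table∈ : ∀ {Y} → Y ∈ subsetsOf A → minorTable Y ∈ map fitsTable (box lo len)
    table∈ Y∈ = let Y⊑A = ∈-subsetsOf⁻ A Y∈ in
      subst (_∈ _) (sym (minorTable≡fitsTable-slack Y⊑A)) (∈-map⁺ fitsTable (slack∈box Y⊑A))

theorem4p5 : ∀ {n : ℕ} (M : PartitionMatroid n) (i : ℕ) → i ≤ n →
    numMinors M i ≤ 2 ^ conn M (prefix n i)
theorem4p5 {n} M i _ = Minors.numMinorTables≤ M (prefix n i)
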